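{- Let $\Sigma$ be a finite alphabet with at least two letters, $\prec_0$ a total order on $\Sigma$ and $\prec_1$ its reverse, and let $w\in\Sigma^*$. For any two distinct runs $r, r'$ of $w$, $\mathit{Beg}(B_r)\cap \mathit{Beg}(B_{r'})=\emptyset$.
   Context: Strings are indexed from 1. An integer $p\ge1$ is a period of $s$ if $s[k]=s[k+p]$ for all $1\le k\le |s|-p$. A run of $w$ (length $n$) is a triple $(i,j,p)$ with $1\le i\le j\le n$ such that $p$ is the smallest period of $w[i..j]$, $j-i+1\ge 2p$, ($i=1$ or $w[i-1]\ne w[i+p-1]$), and ($j=n$ or $w[j+1]\ne w[j-p+1]$). Let $\$\notin\Sigma$ with $\$\prec_0 a$ and $a\prec_1\$$ for all $a\in\Sigma$, and $\hat w=w\$$. Each $\prec_\ell$ also denotes the induced lexicographic order on strings (proper prefix smaller). A nonempty string $u$ is a Lyndon word w.r.t. $\prec_\ell$ if $u\prec_\ell v$ for every nonempty proper suffix $v$ of $u$. An L-root of a run $(i,j,p)$ w.r.t. $\prec_\ell$ is an interval $[i_\lambda..j_\lambda]$ of length $p$ with $i\le i_\lambda\le j_\lambda\le j$ such that $w[i_\lambda..j_\lambda]$ is Lyndon w.r.t. $\prec_\ell$. For a run $r=(i,j,p)$, let $\ell\in\{0,1\}$ be the unique value with $\hat w[j+1]\prec_\ell \hat w[j+1-p]$, and let $B_r$ be the set of all L-roots $[i_\lambda..j_\lambda]$ of $r$ with respect to $\prec_\ell$ with $i_\lambda\ne i$. For a set $I$ of intervals, $\mathit{Beg}(I)$ is the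 set of their beginning positions. -}

module Defs where

open import Data.Nat using (ℕ; zero; suc; _+_; _∸_; _*_; _≤_; _<_)
open import Data.List using (List; []; _∷_; length; take; drop)
open import Data.Maybe using (Maybe; just; nothing)
open import Data.Product using (Σ; _×_; ∃; ∃-syntax; _,_)
open import Data.Sum using (_⊎_)
open import Data.Empty using (⊥)
open import Relation.Nullary using (¬_)
open import Relation.Binary.PropositionalEquality using (_≡_; _≢_)

-- 1-indexed letter access; 'nothing' outside 1..|w|.  In particular
-- at w (|w|+1) = nothing plays the role of the end marker $ of ŵ = w$.
at : {A : Set} → List A → ℕ → Maybe A
at []       _             = nothing
at (x ∷ xs) zero          = nothing
at (x ∷ xs) (suc zero)    = just x
at (x ∷ xs) (suc (suc i)) = at xs (suc i)

factor : {A : Set} → List A → ℕ → ℕ → List A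
factor w i j = take (suc j ∸ i) (drop (i ∸ 1) w)

IsPeriod : {A : Set} → List A → ℕ → Set
IsPeriod s p = 1 ≤ p × (∀ k → 1 ≤ k → k + p ≤ length s → at s k ≡ at s (k + p))

IsSmallestPeriod : {A : Set} → List A → ℕ → Set
IsSmallestPeriod s p = IsPeriod s p × (∀ q → IsPeriod s q → p ≤ q)

IsRun : {A : Set} → List A → ℕ → ℕ → ℕ → Set
IsRun w i j p =
  1 ≤ i × i ≤ j × j ≤ length w ×
  IsSmallestPeriod (factor w i j) p ×
  2 * p ≤ suc j ∸ i ×
  (i ≡ 1 ⊎ at w (i ∸ 1) ≢ at w (i + p ∸ 1)) ×
  (j ≡ length w ⊎ at w (suc j) ≢ at w (suc j ∸ p))

module _ {Σ' : Set} (_≺_ : Σ' → Σ' → Set) where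

  Ord : ℕ → Σ' → Σ' → Set
  Ord zero    a b = a ≺ b
  Ord (suc _) a b = b ≺ a

  -- order ≺_ℓ on Σ ∪ {$}, with $ represented by nothing:
  -- $ ≺_0 a  and  a ≺_1 $  for all a ∈ Σ
  data ExtOrd : ℕ → Maybe Σ' → Maybe Σ' → Set where
    dollar₀ : ∀ {a} → ExtOrd 0 nothing (just a)
    dollar₁ : ∀ {a} → ExtOrd 1 (just a) nothing
    letter  : ∀ {ℓ a b} → Ord ℓ a b → ExtOrd ℓ (just a) (just b)

  data Lex (ℓ : ℕ) : List Σ' → List Σ' → Set where
    halt : ∀ {y ys} → Lex ℓ [] (y ∷ ys)
    this : ∀ {x y xs ys} → Ord ℓ x y → Lex ℓ (x ∷ xs) (y ∷ ys)
    next : ∀ {x xs ys} → Lex ℓ xs ys → Lex ℓ (x ∷ xs) (x ∷ ys)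

  IsLyndon : ℕ → List Σ' → Set
  IsLyndon ℓ u = 1 ≤ length u ×
    (∀ m → 1 ≤ m → m < length u → Lex ℓ u (drop m u))

  IsLRoot : ℕ → List Σ' → ℕ → ℕ → ℕ → ℕ → ℕ → Set
  IsLRoot ℓ w i j p a b =
    suc b ∸ a ≡ p × i ≤ a × a ≤ b × b ≤ j × IsLyndon ℓ (factor w a b)

  RunOrder : List Σ' → ℕ → ℕ → ℕ → ℕ → Set
  RunOrder w i j p ℓ = ℓ ≤ 1 × ExtOrd ℓ (at w (suc j)) (at w (suc j ∸ p))

  InBegB : List Σ' → ℕ → ℕ → ℕ → ℕ → Set
  InBegB w i j p a =
    ∃[ ℓ ] (RunOrder w i j p ℓ × ∃[ b ] (IsLRoot ℓ w i j p a b × a ≢ i))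

-- Let the runs r = (i, j, p) and r' = (i', j', p') have L-roots λ = w[a..a+p-1] and
-- λ' = w[a..a+p'-1] w.r.t. ≺ℓ and ≺ℓ' with a ≠ i, a ≠ i'; then a-1 lies in both runs.
-- If p = p', the period p extends across a-1, so left and right maximality force r = r'.
-- Otherwise say p < p'; then λ is a proper prefix of λ'.
-- * ℓ = ℓ': the period p makes λ' agree with its suffix at offset p as long as r lasts.  Either
--   that suffix is exhausted first, so it is a proper prefix of λ', or the first disagreement is
--   ŵ[j+1] ≺ℓ ŵ[j+1-p]; both contradict λ' being Lyndon.
-- * ℓ ≠ ℓ', p ≥ 2: a Lyndon word of length ≥ 2 has its first letter strictly below its last, and
--   no letter of a Lyndon word is below its first; so λ orders its first and p-th letter one way
--   and λ' the other.
-- * ℓ ≠ ℓ', p = 1: w[a-1] = w[a] and w[a-1] = w[a-1+p'], so the first and last letters of λ'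
--   coincide, which a Lyndon word of length ≥ 2 forbids.

module Submission where

open import Defs
open import Data.Nat using (ℕ; zero; suc; _+_; _∸_; _≤_; _<_; _⊓_; z≤n; s≤s; _≤?_; _≟_)
open import Data.Nat.Properties
open import Data.Nat.Tactic.RingSolver using (solve-∀)
open import Data.List using (List; []; _∷_; length; take; drop)
open import Data.List.Properties using (length-take; length-drop)
open import Data.Maybe using (Maybe; just)
open import Data.Maybe.Properties using (just-injective)
open import Data.Fin using (Fin)
open import Data.Product using (_×_; ∃-syntax; ∃₂; _,_; proj₁; proj₂)
open import Data.Sum using (_⊎_; inj₁; inj₂)
open import Data.Empty using (⊥; ⊥-elim)
open import Function using (id; _∘_)
open import Relation.Nullary using (¬_; yes; no)
open import Relation.Binary.PropositionalEquality
open import Relation.Binary.Structures using (IsStrictPartialOrder; IsStrictTotalOrder)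
open import Relation.Binary.Definitions using (tri<; tri≈; tri>)
open ≡-Reasoning

private variable
  A : Set

at-take : ∀ (xs : List A) {n t} → t < n → at (take n xs) (suc t) ≡ at xs (suc t)
at-take []       {zero}  ()
at-take []       {suc n} _                  = refl
at-take (x ∷ xs) {suc n} {zero}  _          = refl
at-take (x ∷ xs) {suc n} {suc t} (s≤s t<n) = at-take xs t<n

at-drop : ∀ (xs : List A) d t → at (drop d xs) (suc t) ≡ at xs (suc (d + t))
at-drop xs       zero    t = refl
at-drop []       (suc d) t = refl
at-drop (x ∷ xs) (suc d) t = at-drop xs d t

at-factor : ∀ (w : List A) i₀ j {t} → t < j ∸ i₀ →
            at (factor w (suc i₀) j) (suc t) ≡ at w (suc (i₀ + t))
at-factor w i₀ j t<len = trans (at-take (drop i₀ w) t<len) (at-drop w i₀ _)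

length-factor : ∀ (w : List A) i₀ j → j ≤ length w → length (factor w (suc i₀) j) ≡ j ∸ i₀
length-factor w i₀ j j≤n = begin
  length (take (j ∸ i₀) (drop i₀ w)) ≡⟨ length-take (j ∸ i₀) (drop i₀ w) ⟩
  (j ∸ i₀) ⊓ length (drop i₀ w)      ≡⟨ cong ((j ∸ i₀) ⊓_) (length-drop i₀ w) ⟩
  (j ∸ i₀) ⊓ (length w ∸ i₀)         ≡⟨ m≤n⇒m⊓n≡m (∸-monoˡ-≤ i₀ j≤n) ⟩
  j ∸ i₀                             ∎

factor-period : ∀ (w : List A) i₀ j {p} → j ≤ length w → IsPeriod (factor w (suc i₀) j) p →
                ∀ x → suc i₀ ≤ x → x + p ≤ j → at w x ≡ at w (x + p)
factor-period w i₀ j {p} j≤n (_ , period) x i≤x x+p≤j with m≤n⇒∃[o]m+o≡n i≤x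
... | t , refl = begin
  at w (suc (i₀ + t))                     ≡⟨ at-factor w i₀ j t<len ⟨
  at (factor w (suc i₀) j) (suc t)        ≡⟨ period (suc t) (s≤s z≤n) t+p<length ⟩
  at (factor w (suc i₀) j) (suc (t + p))  ≡⟨ at-factor w i₀ j t+p<len ⟩
  at w (suc (i₀ + (t + p)))               ≡⟨ cong (at w ∘ suc) (+-assoc i₀ t p) ⟨
  at w (suc (i₀ + t) + p)                 ∎
  where
    reorder : ∀ i₀ t p → suc (i₀ + t) + p ≡ suc (t + p) + i₀
    reorder = solve-∀
    t+p<len : t + p < j ∸ i₀
    t+p<len = m+n≤o⇒m≤o∸n (suc (t + p)) (subst (_≤ j) (reorder i₀ t p) x+p≤j)
    t<len : t < j ∸ i₀
    t<len = ≤-<-trans (m≤m+n t p) t+p<len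
    t+p<length : suc t + p ≤ length (factor w (suc i₀) j)
    t+p<length = subst (suc (t + p) ≤_) (sym (length-factor w i₀ j j≤n)) t+p<len

Agree : ℕ → List A → List A → Set
Agree m x y = ∀ t → t < m → at x (suc t) ≡ at y (suc t)

module Lexicographic {A : Set} (_≺_ : A → A → Set) (≺-spo : IsStrictPartialOrder _≡_ _≺_) where
  open IsStrictPartialOrder ≺-spo using (irrefl; asym)

  Ord-irrefl : ∀ ℓ {c} → ¬ Ord _≺_ ℓ c c
  Ord-irrefl zero    = irrefl refl
  Ord-irrefl (suc _) = irrefl refl

  Ord-asym : ∀ ℓ {c d} → Ord _≺_ ℓ c d → ¬ Ord _≺_ ℓ d c
  Ord-asym zero    = asym
  Ord-asym (suc _) = asym

  Ord-flip : ∀ {ℓ ℓ' c d} → ℓ ≤ 1 → ℓ' ≤ 1 → ℓ ≢ ℓ' → Ord _≺_ ℓ c d → Ord _≺_ ℓ' d c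
  Ord-flip {zero}        {zero}        _        _        ℓ≢ℓ' = ⊥-elim (ℓ≢ℓ' refl)
  Ord-flip {zero}        {suc _}       _        _        _    = id
  Ord-flip {suc _}       {zero}        _        _        _    = id
  Ord-flip {suc zero}    {suc zero}    _        _        ℓ≢ℓ' = ⊥-elim (ℓ≢ℓ' refl)
  Ord-flip {suc (suc _)} {suc _}       (s≤s ()) _        _
  Ord-flip {suc zero}    {suc (suc _)} _        (s≤s ()) _

  Lex-prefix : ∀ {ℓ} m {x y} → Agree m x y → length y ≤ m → ¬ Lex _≺_ ℓ x y
  Lex-prefix     zero    {y = _ ∷ _} _     ()          _
  Lex-prefix     (suc m) {y = _ ∷ _} agree _           halt       with agree 0 (s≤s z≤n)
  ... | ()
  Lex-prefix {ℓ} (suc m) {y = _ ∷ _} agree _           (this c≺d) with agree 0 (s≤s z≤n)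
  ... | refl = Ord-irrefl ℓ c≺d
  Lex-prefix     (suc m) {y = _ ∷ _} agree (s≤s len≤m) (next l) =
    Lex-prefix m (λ t t<m → agree (suc t) (s≤s t<m)) len≤m l

  Lex-mismatch : ∀ {ℓ} m {x y} → Agree m x y → m < length x →
                 ExtOrd _≺_ ℓ (at y (suc m)) (at x (suc m)) → ¬ Lex _≺_ ℓ x y
  Lex-mismatch {ℓ} zero    _     _           (letter d≺c) (this c≺d) = Ord-asym ℓ c≺d d≺c
  Lex-mismatch {ℓ} zero    _     _           (letter c≺c) (next _)   = Ord-irrefl ℓ c≺c
  Lex-mismatch {ℓ} (suc m) agree _           _            (this c≺d) with agree 0 (s≤s z≤n)
  ... | refl = Ord-irrefl ℓ c≺d
  Lex-mismatch     (suc m) agree (s≤s m<len) d≺c          (next l) =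
    Lex-mismatch m (λ t t<m → agree (suc t) (s≤s t<m)) m<len d≺c l

  Lex-∷-last : ∀ {ℓ c xs} m ys → length ys ≡ suc m → Lex _≺_ ℓ (c ∷ xs) (drop m ys) →
               ∃[ d ] at ys (suc m) ≡ just d × Ord _≺_ ℓ c d
  Lex-∷-last zero    (d ∷ []) _   (this c≺d) = d , refl , c≺d
  Lex-∷-last zero    (d ∷ []) _   (next ())
  Lex-∷-last (suc m) (_ ∷ ys) len l          = Lex-∷-last m ys (suc-injective len) l

  Lyndon-head≺last : ∀ {ℓ u m} → IsLyndon _≺_ ℓ u → length u ≡ suc (suc m) →
                     ∃₂ λ c d → at u 1 ≡ just c × at u (suc (suc m)) ≡ just d × Ord _≺_ ℓ c d
  Lyndon-head≺last {u = c ∷ us} {m} (_ , lyndon) len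
    with d , d≡ , c≺d ← Lex-∷-last m us (suc-injective len)
                          (lyndon (suc m) (s≤s z≤n) (≤-reflexive (sym len)))
    = c , d , refl , d≡ , c≺d

  Lyndon-head-minimal : ∀ {ℓ u s c d} → IsLyndon _≺_ ℓ u → 1 ≤ s → s < length u →
                        at u 1 ≡ just c → at u (suc s) ≡ just d → ¬ Ord _≺_ ℓ d c
  Lyndon-head-minimal {u = u} {s} {d = d} (_ , lyndon) 1≤s s<len c≡ d≡ d≺c =
    Lex-mismatch 0 (λ _ ()) (≤-<-trans z≤n s<len)
      (subst₂ (ExtOrd _ _) suffix-head (sym c≡) (letter d≺c)) (lyndon s 1≤s s<len)
    where
      suffix-head : just d ≡ at (drop s u) 1
      suffix-head = begin
        just d              ≡⟨ d≡ ⟨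
        at u (suc s)        ≡⟨ cong (at u ∘ suc) (+-identityʳ s) ⟨
        at u (suc (s + 0))  ≡⟨ at-drop u s 0 ⟨
        at (drop s u) 1     ∎

module Runs {A : Set} (_≺_ : A → A → Set) (≺-spo : IsStrictPartialOrder _≡_ _≺_) (w : List A) where
  open Lexicographic _≺_ ≺-spo

  W : ℕ → Maybe A
  W = at w

  root : ℕ → ℕ → List A
  root a₀ q = factor w (suc a₀) (a₀ + q)

  at-root : ∀ a₀ {q t} → t < q → at (root a₀ q) (suc t) ≡ W (suc (a₀ + t))
  at-root a₀ {q} t<q = at-factor w a₀ (a₀ + q) (subst (_ <_) (sym (m+n∸m≡n a₀ q)) t<q)

  root-prefix : ∀ a₀ {q q' t} → t < q → q ≤ q' → at (root a₀ q') (suc t) ≡ at (root a₀ q) (suc t)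
  root-prefix a₀ t<q q≤q' = trans (at-root a₀ (<-≤-trans t<q q≤q')) (sym (at-root a₀ t<q))

  length-root : ∀ {a₀ q} → a₀ + q ≤ length w → length (root a₀ q) ≡ q
  length-root {a₀} {q} root≤n = trans (length-factor w a₀ (a₀ + q) root≤n) (m+n∸m≡n a₀ q)

  -- The run (i, j, p) with an L-root w.r.t. ≺ℓ at [a₀+1 .. a₀+p] other than [i .. i+p-1];
  -- the position a₀ just before the root therefore still lies in the run.
  record RootedRun (ℓ a₀ i j p : ℕ) : Set where
    field
      1≤i           : 1 ≤ i
      i≤a₀          : i ≤ a₀
      root≤j        : a₀ + p ≤ j
      j≤n           : j ≤ length w
      1≤p           : 1 ≤ p
      period        : ∀ x → i ≤ x → x + p ≤ j → W x ≡ W (x + p)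
      left-maximal  : i ≡ 1 ⊎ W (i ∸ 1) ≢ W (i + p ∸ 1)
      right-maximal : j ≡ length w ⊎ W (suc j) ≢ W (suc j ∸ p)
      ℓ≤1           : ℓ ≤ 1
      run-order     : ExtOrd _≺_ ℓ (W (suc j)) (W (suc j ∸ p))
      lyndon        : IsLyndon _≺_ ℓ (root a₀ p)

    root≤n : a₀ + p ≤ length w
    root≤n = ≤-trans root≤j j≤n

    lyndon-shift : ∀ {s} → 1 ≤ s → s < p → Lex _≺_ ℓ (root a₀ p) (drop s (root a₀ p))
    lyndon-shift 1≤s s<p = proj₂ lyndon _ 1≤s (subst (_ <_) (sym (length-root root≤n)) s<p)

  open RootedRun

  rooted : ∀ {i j p a₀} → IsRun w i j p → InBegB _≺_ w i j p (suc a₀) → ∃[ ℓ ] RootedRun ℓ a₀ i j p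
  rooted {suc i₀} {j} {p} {a₀} (1≤i , _ , j≤n , (p-period , _) , _ , left , right)
         (ℓ , (ℓ≤1 , order) , b , (b∸a₀≡p , i≤a , a≤b , b≤j , b-lyndon) , a≢i) = ℓ , record
    { 1≤i           = 1≤i
    ; i≤a₀          = ≤-pred (≤∧≢⇒< i≤a (a≢i ∘ sym))
    ; root≤j        = subst (_≤ j) b≡a₀+p b≤j
    ; j≤n           = j≤n
    ; 1≤p           = proj₁ p-period
    ; period        = factor-period w i₀ j j≤n p-period
    ; left-maximal  = left
    ; right-maximal = right
    ; ℓ≤1           = ℓ≤1
    ; run-order     = order
    ; lyndon        = subst (IsLyndon _≺_ ℓ ∘ factor w (suc a₀)) b≡a₀+p b-lyndon
    }
    where
      b≡a₀+p : b ≡ a₀ + p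
      b≡a₀+p = trans (sym (m+[n∸m]≡n (≤-trans (n≤1+n a₀) a≤b))) (cong (a₀ +_) b∸a₀≡p)

  ¬InBegB-zero : ∀ {i j p} → IsRun w i j p → ¬ InBegB _≺_ w i j p 0
  ¬InBegB-zero (s≤s _ , _) (_ , _ , _ , (_ , () , _) , _)

  ¬later-start : ∀ {ℓ ℓ' a₀ i j i' j' p} → RootedRun ℓ a₀ i j p → RootedRun ℓ' a₀ i' j' p → ¬ i < i'
  ¬later-start {i' = suc i₀'} {p = p} ρ ρ' i<i' with left-maximal ρ'
  ... | inj₁ refl    = <-irrefl refl (≤-trans (s≤s (1≤i ρ)) i<i')
  ... | inj₂ differs = differs (period ρ i₀' (≤-pred i<i') i₀'+p≤j)
    where
      i₀'+p≤j : i₀' + p ≤ _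
      i₀'+p≤j = ≤-trans (+-monoˡ-≤ p (≤-trans (n≤1+n i₀') (i≤a₀ ρ'))) (root≤j ρ)

  ¬earlier-end : ∀ {ℓ ℓ' a₀ i j i' j' p} → RootedRun ℓ a₀ i j p → RootedRun ℓ' a₀ i' j' p → ¬ j < j'
  ¬earlier-end {a₀ = a₀} {j = j} {j' = j'} {p} ρ ρ' j<j' with right-maximal ρ
  ... | inj₁ refl    = <-irrefl refl (≤-trans j<j' (j≤n ρ'))
  ... | inj₂ differs = differs (sym (begin
    W (suc j ∸ p)     ≡⟨ period ρ' (suc j ∸ p) i'≤x (subst (_≤ j') (sym x+p≡1+j) j<j') ⟩
    W (suc j ∸ p + p) ≡⟨ cong W x+p≡1+j ⟩
    W (suc j)         ∎))
    where
      root≤1+j : a₀ + p ≤ suc j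
      root≤1+j = ≤-trans (root≤j ρ) (n≤1+n j)
      x+p≡1+j : suc j ∸ p + p ≡ suc j
      x+p≡1+j = m∸n+n≡m (m+n≤o⇒n≤o a₀ root≤1+j)
      i'≤x : _ ≤ suc j ∸ p
      i'≤x = ≤-trans (i≤a₀ ρ') (m+n≤o⇒m≤o∸n a₀ root≤1+j)

  same-period⇒same-run : ∀ {ℓ ℓ' a₀ i j i' j' p} → RootedRun ℓ a₀ i j p → RootedRun ℓ' a₀ i' j' p →
                         (i , j) ≡ (i' , j')
  same-period⇒same-run ρ ρ' =
    cong₂ _,_ (≤-antisym (≮⇒≥ (¬later-start ρ' ρ)) (≮⇒≥ (¬later-start ρ ρ')))
              (≤-antisym (≮⇒≥ (¬earlier-end ρ' ρ)) (≮⇒≥ (¬earlier-end ρ ρ')))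

  periodic-prefix : ∀ {ℓ a₀ i j p q e} → RootedRun ℓ a₀ i j p → p + e ≤ q → a₀ + p + e ≤ j →
                    Agree e (root a₀ q) (drop p (root a₀ q))
  periodic-prefix {a₀ = a₀} {i} {j} {p} {q} {e} ρ p+e≤q root+e≤j t t<e = begin
    at (root a₀ q) (suc t)           ≡⟨ at-root a₀ t<q ⟩
    W (suc (a₀ + t))                 ≡⟨ period ρ (suc (a₀ + t)) i≤x x+p≤j ⟩
    W (suc (a₀ + t) + p)             ≡⟨ cong W (shift a₀ t p) ⟩
    W (suc (a₀ + (p + t)))           ≡⟨ at-root a₀ p+t<q ⟨
    at (root a₀ q) (suc (p + t))     ≡⟨ at-drop (root a₀ q) p t ⟨
    at (drop p (root a₀ q)) (suc t)  ∎
    where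
      shift : ∀ a₀ t p → suc (a₀ + t) + p ≡ suc (a₀ + (p + t))
      shift = solve-∀
      reorder : ∀ a₀ t p → suc (a₀ + t) + p ≡ a₀ + p + suc t
      reorder = solve-∀
      p+t<q : p + t < q
      p+t<q = <-≤-trans (+-monoʳ-< p t<e) p+e≤q
      t<q : t < q
      t<q = ≤-<-trans (m≤n+m t p) p+t<q
      i≤x : i ≤ suc (a₀ + t)
      i≤x = ≤-trans (i≤a₀ ρ) (≤-trans (m≤m+n a₀ t) (n≤1+n _))
      x+p≤j : suc (a₀ + t) + p ≤ j
      x+p≤j = subst (_≤ j) (sym (reorder a₀ t p)) (≤-trans (+-monoʳ-≤ (a₀ + p) t<e) root+e≤j)

  ¬shorter-period-covered : ∀ {ℓ a₀ i j i' j' p p'} → RootedRun ℓ a₀ i j p →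
                            RootedRun ℓ a₀ i' j' p' → p < p' → a₀ + p' ≤ j → ⊥
  ¬shorter-period-covered {a₀ = a₀} {j = j} {p = p} {p'} ρ ρ' p<p' root'≤j =
    Lex-prefix (p' ∸ p) (periodic-prefix ρ (≤-reflexive p+[p'∸p]≡p') root+e≤j) suffix-length
      (lyndon-shift ρ' (1≤p ρ) p<p')
    where
      p+[p'∸p]≡p' : p + (p' ∸ p) ≡ p'
      p+[p'∸p]≡p' = m+[n∸m]≡n (<⇒≤ p<p')
      root+e≤j : a₀ + p + (p' ∸ p) ≤ j
      root+e≤j = subst (_≤ j) (sym (trans (+-assoc a₀ p _) (cong (a₀ +_) p+[p'∸p]≡p'))) root'≤j
      suffix-length : length (drop p (root a₀ p')) ≤ p' ∸ p
      suffix-length = ≤-reflexive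
        (trans (length-drop p (root a₀ p')) (cong (_∸ p) (length-root (root≤n ρ'))))

  ¬shorter-period-uncovered : ∀ {ℓ a₀ i i' j' p m p'} → RootedRun ℓ a₀ i (a₀ + p + m) p →
                              RootedRun ℓ a₀ i' j' p' → p + m < p' → ⊥
  ¬shorter-period-uncovered {ℓ} {a₀} {p = p} {m} {p'} ρ ρ' p+m<p' =
    Lex-mismatch m (periodic-prefix ρ (<⇒≤ p+m<p') ≤-refl)
      (subst (m <_) (sym (length-root (root≤n ρ'))) m<p')
      (subst₂ (ExtOrd _≺_ ℓ) suffix-letter head-letter (run-order ρ))
      (lyndon-shift ρ' (1≤p ρ) (≤-<-trans (m≤m+n p m) p+m<p'))
    where
      m<p' : m < p'
      m<p' = ≤-<-trans (m≤n+m m p) p+m<p'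
      suffix-letter : W (suc (a₀ + p + m)) ≡ at (drop p (root a₀ p')) (suc m)
      suffix-letter = begin
        W (suc (a₀ + p + m))              ≡⟨ cong (W ∘ suc) (+-assoc a₀ p m) ⟩
        W (suc (a₀ + (p + m)))            ≡⟨ at-root a₀ p+m<p' ⟨
        at (root a₀ p') (suc (p + m))     ≡⟨ at-drop (root a₀ p') p m ⟨
        at (drop p (root a₀ p')) (suc m)  ∎
      reorder : ∀ a₀ p m → suc (a₀ + p + m) ≡ suc (a₀ + m) + p
      reorder = solve-∀
      head-letter : W (suc (a₀ + p + m) ∸ p) ≡ at (root a₀ p') (suc m)
      head-letter = begin
        W (suc (a₀ + p + m) ∸ p)  ≡⟨ cong (W ∘ (_∸ p)) (reorder a₀ p m) ⟩
        W (suc (a₀ + m) + p ∸ p)  ≡⟨ cong W (m+n∸n≡m (suc (a₀ + m)) p) ⟩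
        W (suc (a₀ + m))          ≡⟨ at-root a₀ m<p' ⟨
        at (root a₀ p') (suc m)   ∎

  ¬shorter-period-same-order : ∀ {ℓ a₀ i j i' j' p p'} → RootedRun ℓ a₀ i j p →
                               RootedRun ℓ a₀ i' j' p' → ¬ p < p'
  ¬shorter-period-same-order {a₀ = a₀} {j = j} {p = p} {p'} ρ ρ' p<p' with a₀ + p' ≤? j
  ... | yes root'≤j = ¬shorter-period-covered ρ ρ' p<p' root'≤j
  ... | no  root'≰j with m≤n⇒∃[o]m+o≡n (root≤j ρ)
  ...   | m , refl = ¬shorter-period-uncovered ρ ρ' (+-cancelˡ-< a₀ _ _ j<root')
    where
      j<root' : a₀ + (p + m) < a₀ + p'
      j<root' = subst (_< a₀ + p') (+-assoc a₀ p m) (≰⇒> root'≰j)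

  ¬unit-period : ∀ {ℓ ℓ' a₀ i j i' j' p'} → RootedRun ℓ a₀ i j 1 → RootedRun ℓ' a₀ i' j' p' → ¬ 1 < p'
  ¬unit-period {p' = suc zero} _ _ (s≤s ())
  ¬unit-period {ℓ' = ℓ'} {a₀} {p' = suc (suc q)} ρ ρ' _
    with c , d , c≡ , d≡ , c≺d ← Lyndon-head≺last (lyndon ρ') (length-root (root≤n ρ'))
    = Ord-irrefl ℓ' (subst (Ord _≺_ ℓ' c) (sym c≡d) c≺d)
    where
      head≡last : at (root a₀ (suc (suc q))) 1 ≡ at (root a₀ (suc (suc q))) (suc (suc q))
      head≡last = begin
        at (root a₀ (suc (suc q))) 1            ≡⟨ at-root a₀ (s≤s z≤n) ⟩
        W (suc (a₀ + 0))                        ≡⟨ cong (W ∘ suc) (+-identityʳ a₀) ⟩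
        W (suc a₀)                              ≡⟨ cong W (+-comm 1 a₀) ⟩
        W (a₀ + 1)                              ≡⟨ period ρ a₀ (i≤a₀ ρ) (root≤j ρ) ⟨
        W a₀                                    ≡⟨ period ρ' a₀ (i≤a₀ ρ') (root≤j ρ') ⟩
        W (a₀ + suc (suc q))                    ≡⟨ cong W (+-suc a₀ (suc q)) ⟩
        W (suc (a₀ + suc q))                    ≡⟨ at-root a₀ ≤-refl ⟨
        at (root a₀ (suc (suc q))) (suc (suc q)) ∎
      c≡d : c ≡ d
      c≡d = just-injective (trans (sym c≡) (trans head≡last d≡))

  ¬shorter-period-opposite-orders : ∀ {ℓ ℓ' a₀ i j i' j' q p'} → ℓ ≢ ℓ' →
                                    RootedRun ℓ a₀ i j (suc (suc q)) → RootedRun ℓ' a₀ i' j' p' →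
                                    ¬ suc (suc q) < p'
  ¬shorter-period-opposite-orders {a₀ = a₀} {q = q} ℓ≢ℓ' ρ ρ' p<p'
    with c , d , c≡ , d≡ , c≺d ← Lyndon-head≺last (lyndon ρ) (length-root (root≤n ρ))
    = Lyndon-head-minimal (lyndon ρ') (s≤s z≤n)
        (subst (suc q <_) (sym (length-root (root≤n ρ'))) (<⇒≤ p<p'))
        (trans (root-prefix a₀ (s≤s z≤n) (<⇒≤ p<p')) c≡)
        (trans (root-prefix a₀ ≤-refl (<⇒≤ p<p')) d≡)
        (Ord-flip (ℓ≤1 ρ) (ℓ≤1 ρ') ℓ≢ℓ' c≺d)

  ¬shorter-period : ∀ {ℓ ℓ' a₀ i j i' j' p p'} → RootedRun ℓ a₀ i j p → RootedRun ℓ' a₀ i' j' p' →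
                    ¬ p < p'
  ¬shorter-period {ℓ} {ℓ'} ρ ρ' p<p' with ℓ ≟ ℓ'
  ... | yes refl = ¬shorter-period-same-order ρ ρ' p<p'
  ¬shorter-period {p = zero}        ρ _  _    | no _    = n≮0 (1≤p ρ)
  ¬shorter-period {p = suc zero}    ρ ρ' p<p' | no _    = ¬unit-period ρ ρ' p<p'
  ¬shorter-period {p = suc (suc _)} ρ ρ' p<p' | no ℓ≢ℓ' =
    ¬shorter-period-opposite-orders ℓ≢ℓ' ρ ρ' p<p'

  same-root⇒same-run : ∀ {ℓ ℓ' a₀ i j i' j' p p'} → RootedRun ℓ a₀ i j p → RootedRun ℓ' a₀ i' j' p' →
                       (i , j , p) ≡ (i' , j' , p')
  same-root⇒same-run ρ ρ' with <-cmp _ _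
  ... | tri< p<p' _ _ = ⊥-elim (¬shorter-period ρ ρ' p<p')
  ... | tri> _ _ p'<p = ⊥-elim (¬shorter-period ρ' ρ p'<p)
  ... | tri≈ _ refl _ with same-period⇒same-run ρ ρ'
  ...   | refl = refl

lemma4 : (k : ℕ) → 2 ≤ k →
         (_≺_ : Fin k → Fin k → Set) → IsStrictTotalOrder _≡_ _≺_ →
         (w : List (Fin k)) →
         (i j p i' j' p' : ℕ) →
         IsRun w i j p → IsRun w i' j' p' →
         (i , j , p) ≢ (i' , j' , p') →
         (a : ℕ) → InBegB _≺_ w i j p a → InBegB _≺_ w i' j' p' a → ⊥
lemma4 _ _ _≺_ ≺-sto w _ _ _ _ _ _ r r' r≢r' zero B _ = ¬InBegB-zero r B
  where open Runs _≺_ (IsStrictTotalOrder.isStrictPartialOrder ≺-sto) w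
lemma4 _ _ _≺_ ≺-sto w _ _ _ _ _ _ r r' r≢r' (suc a₀) B B' =
  r≢r' (same-root⇒same-run (proj₂ (rooted r B)) (proj₂ (rooted r' B')))
  where open Runs _≺_ (IsStrictTotalOrder.isStrictPartialOrder ≺-sto) w
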